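{- Let $n$ and $k$ be positive integers, and let $c\colon E(K_{2kn})\to [k]$ be a colour-balanced edge-colouring of the complete graph $K_{2kn}$ on $2kn$ vertices, where $[k]=\{1,2,\dots,k\}$. Then there is a perfect matching $M$ of $K_{2kn}$ satisfying $$f(M)\le k\sqrt{2n},\qquad\text{where}\qquad f(M)=\sum_{i=1}^k\Bigl|\,|c^{ -1}(i)\cap M|-n\,\Bigr|.$$
   Context: An edge-colouring $c\colon E(G)\to[k]$ of a graph $G$ is called colour-balanced if each colour $i\in[k]$ is used on exactly the same number of edges, i.e. $|c^{ -1}(i)|=|E(G)|/k$ for all $i$. For a perfect matching $M$, $|c^{ -1}(i)\cap M|$ is the number of edges of $M$ having colour $i$. -}

module Defs where

open import Data.Nat using (ℕ; _+_; _*_; _^_; ∣_-_∣)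
open import Data.Fin using (Fin; _<_; _<?_)
open import Data.Fin.Properties using (_≟_)
open import Data.List using (List; length; filter; allFin; concatMap; map)
open import Data.Nat.ListAction using (sum)
open import Data.Product using (_×_; _,_; proj₁; proj₂)
open import Relation.Binary.PropositionalEquality using (_≡_; _≢_)
open import Relation.Nullary using (Dec; yes; no; _×-dec_)

-- The complete graph K_N has vertex set Fin N; its edges are the
-- unordered pairs {u,v} with u ≠ v, represented canonically by the
-- ordered pairs (u , v) with u < v.
allPairs : (N : ℕ) → List (Fin N × Fin N)
allPairs N = concatMap (λ u → map (λ v → (u , v)) (allFin N)) (allFin N)

edges : (N : ℕ) → List (Fin N × Fin N)
edges N = filter (λ p → proj₁ p <? proj₂ p) (allPairs N)

numEdges : ℕ → ℕ
numEdges N = length (edges N)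

-- An edge-colouring of K_N with k colours: a symmetric function on pairs
-- of vertices (its values on the diagonal u = v are irrelevant).
record EdgeColouring (N k : ℕ) : Set where
  field
    col : Fin N → Fin N → Fin k
    sym : ∀ u v → col u v ≡ col v u
open EdgeColouring public

colourClassSize : ∀ {N k} → EdgeColouring N k → Fin k → ℕ
colourClassSize {N} c i = length (filter (λ p → col c (proj₁ p) (proj₂ p) ≟ i) (edges N))

-- colour-balanced: |c⁻¹(i)| = |E|/k for all i, stated division-free as
-- |c⁻¹(i)| * k = |E|.
ColourBalanced : ∀ {N k} → EdgeColouring N k → Set
ColourBalanced {N} {k} c = ∀ i → colourClassSize c i * k ≡ numEdges N

-- A perfect matching of K_N, given by its partner function: a fixed-point
-- free involution m; its edges are the pairs {v , m v}.
record PerfectMatching (N : ℕ) : Set where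
  field
    partner : Fin N → Fin N
    involutive : ∀ v → partner (partner v) ≡ v
    noFixed : ∀ v → partner v ≢ v
open PerfectMatching public

matchingEdges : ∀ {N} → PerfectMatching N → List (Fin N × Fin N)
matchingEdges {N} M =
  filter (λ p → proj₁ p <? proj₂ p) (map (λ v → (v , partner M v)) (allFin N))

colourCountIn : ∀ {N k} → EdgeColouring N k → PerfectMatching N → Fin k → ℕ
colourCountIn c M i =
  length (filter (λ p → col c (proj₁ p) (proj₂ p) ≟ i) (matchingEdges M))

fM : ∀ {N k} → EdgeColouring N k → ℕ → PerfectMatching N → ℕ
fM {k = k} c n M = sum (map (λ i → ∣ colourCountIn c M i - n ∣) (allFin k))

module Submission where

-- For a perfect matching M with xᵢ edges of colour i, let Ψ(M) = ∑ᵢ (2xᵢ − 2n)². Replacing two matching edges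
-- {u, p u}, {v, p v} by {u, v}, {p u, p v} raises Ψ by at most 4Δ(u, v) + 32, where Δ(u, v) is a signed sum of the
-- excesses 2xⱼ − 2n of the four colours involved, and Δ(u, p u) = 0. As the colouring is balanced, the excess of the
-- colour of an edge averages to 0 over all edges, and summing over all ordered pairs u ≠ v gives
-- ∑ (4Δ + 32) = −8(N − 1)(Ψ − 4N). So while Ψ > 4N some switch decreases Ψ; hence a matching with
-- ∑ᵢ (xᵢ − n)² = Ψ/4 ≤ N exists, and Cauchy–Schwarz gives f(M)² ≤ k ∑ᵢ (xᵢ − n)² ≤ kN = 2nk².

open import Defs hiding (sym)

module _ where

  open import Level using (Level)
  open import Function using (_∘_; const; id)
  open import Data.Nat as ℕ using (ℕ; zero; suc)
  import Data.Nat.Properties as ℕ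
  import Data.Nat.Induction as ℕ
  open import Data.Nat.ListAction as ℕ using ()
  open import Data.Nat.Tactic.RingSolver using () renaming (solve-∀ to ℕ-solve-∀)
  open import Data.Integer as ℤ using (ℤ; ∣_∣; +_; _+_; _*_; -_; _-_; _≤_; _<_; 0ℤ; 1ℤ)
  import Data.Integer.Properties as ℤ
  open import Data.Integer.Tactic.RingSolver using (solve-∀)
  open import Data.Fin using (Fin; zero; suc; _<?_; join; splitAt)
  open import Data.Fin.Properties using (_≟_; suc-injective; <-cmp; splitAt-join; join-splitAt)
  open import Data.Fin.Permutation using (permutation)
  open import Data.Vec.Functional using (updateAt)
  open import Data.Vec.Functional.Properties using (updateAt-updates; updateAt-minimal)
  open import Data.List using (List; []; _∷_; _++_; length; filter; map; concatMap; allFin; tabulate)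
  open import Data.Product using (∃; ∃₂; _×_; _,_)
  open import Data.Sum as Sum using (_⊎_; inj₁; inj₂)
  import Data.Sum.Properties as Sum
  open import Induction.WellFounded using (Acc; acc)
  open import Relation.Binary.Definitions using (tri<; tri≈; tri>)
  open import Relation.Binary.PropositionalEquality
  open import Relation.Nullary using (Dec; yes; no; ¬_)
  open import Relation.Nullary.Negation using (contradiction)
  open import Relation.Unary using (Decidable)
  open import Algebra.Properties.Semiring.Sum ℤ.+-*-semiring
    using (sum; sum-syntax; sum-cong-≗; ∑-distrib-+; ∑-comm; sum-permute; *-distribˡ-sum; *-distribʳ-sum)

  private
    variable
      ℓ₁ ℓ₂ ℓ : Level
      A : Set ℓ₁
      B : Set ℓ₂
      P : A → Set ℓ

  𝟙 : ∀ {p} {P : Set p} → Dec P → ℤ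
  𝟙 (yes _) = 1ℤ
  𝟙 (no _)  = 0ℤ

  module _ {p} {P : Set p} where

    𝟙-yes : (d : Dec P) → P → 𝟙 d ≡ 1ℤ
    𝟙-yes (yes _) _ = refl
    𝟙-yes (no ¬x) x = contradiction x ¬x

    𝟙-no : (d : Dec P) → ¬ P → 𝟙 d ≡ 0ℤ
    𝟙-no (yes x) ¬x = contradiction x ¬x
    𝟙-no (no _)  _  = refl

    𝟙-cong : ∀ {q} {Q : Set q} (d : Dec P) (e : Dec Q) → (P → Q) → (Q → P) → 𝟙 d ≡ 𝟙 e
    𝟙-cong (yes _) (yes _) _   _   = refl
    𝟙-cong (yes x) (no ¬y) p→q _   = contradiction (p→q x) ¬y
    𝟙-cong (no ¬x) (yes y) _   q→p = contradiction (q→p y) ¬x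
    𝟙-cong (no _)  (no _)  _   _   = refl

  𝟙-≟-sym : ∀ {n} (i j : Fin n) → 𝟙 (i ≟ j) ≡ 𝟙 (j ≟ i)
  𝟙-≟-sym i j = 𝟙-cong (i ≟ j) (j ≟ i) sym sym

  𝟙-diff-square-≤ : ∀ {ℓ ℓ′} {P : Set ℓ} {Q : Set ℓ′} (x : Dec P) (y : Dec Q) → (𝟙 x - 𝟙 y) * (𝟙 x - 𝟙 y) ≤ 𝟙 x + 𝟙 y
  𝟙-diff-square-≤ (yes _) (yes _) = ℤ.+≤+ ℕ.z≤n
  𝟙-diff-square-≤ (yes _) (no _)  = ℤ.≤-refl
  𝟙-diff-square-≤ (no _)  (yes _) = ℤ.≤-refl
  𝟙-diff-square-≤ (no _)  (no _)  = ℤ.≤-refl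

  ∣m-n∣≡∣+m-+n∣ : ∀ m n → ℕ.∣ m - n ∣ ≡ ∣ + m - + n ∣
  ∣m-n∣≡∣+m-+n∣ m n = trans ∣m-n∣≡∣m⊖n∣ (cong ∣_∣ (sym (ℤ.m-n≡m⊖n m n)))
    where
    ∣m-n∣≡∣m⊖n∣ : ℕ.∣ m - n ∣ ≡ ∣ m ℤ.⊖ n ∣
    ∣m-n∣≡∣m⊖n∣ with ℕ.≤-total m n
    ... | inj₁ m≤n = trans (ℕ.m≤n⇒∣m-n∣≡n∸m m≤n) (sym (ℤ.∣⊖∣-≤ m≤n))
    ... | inj₂ n≤m = trans (ℕ.m≤n⇒∣n-m∣≡n∸m n≤m) (sym (trans (ℤ.∣m⊖n∣≡∣n⊖m∣ m n) (ℤ.∣⊖∣-≤ n≤m)))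

  +∣i∣-square : ∀ i → + ∣ i ∣ * + ∣ i ∣ ≡ i * i
  +∣i∣-square (+ _)      = refl
  +∣i∣-square ℤ.-[1+ _ ] = refl

  *-positive : ∀ {x y} → 0ℤ < x → 0ℤ < y → 0ℤ < x * y
  *-positive {x} {y} 0<x 0<y = subst (_< x * y) (ℤ.*-zeroʳ x) (ℤ.*-monoˡ-<-pos x {{ℤ.positive 0<x}} 0<y)

  i<j⇒0<j-i : ∀ {x y} → x < y → 0ℤ < y - x
  i<j⇒0<j-i {x} {y} x<y = subst (_< y - x) (ℤ.+-inverseʳ x) (ℤ.+-monoˡ-< (- x) x<y)

  square-nonNeg : ∀ x → 0ℤ ≤ x * x
  square-nonNeg (+ n)      = subst (0ℤ ≤_) (ℤ.pos-* n n) (ℤ.+≤+ ℕ.z≤n)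
  square-nonNeg ℤ.-[1+ n ] = ℤ.+≤+ ℕ.z≤n

  i+i≡2*i : ∀ x → x + x ≡ + 2 * x
  i+i≡2*i = solve-∀

  square-+-≤ : ∀ x y → (x + y) * (x + y) ≤ + 2 * (x * x) + + 2 * (y * y)
  square-+-≤ x y = ℤ.0≤i-j⇒j≤i (subst (0ℤ ≤_) (gap x y) (square-nonNeg (x - y)))
    where
    gap : ∀ x y → (x - y) * (x - y) ≡ + 2 * (x * x) + + 2 * (y * y) - (x + y) * (x + y)
    gap = solve-∀

  ∑-const : ∀ n (x : ℤ) → ∑[ i < n ] x ≡ + n * x
  ∑-const zero    x = refl
  ∑-const (suc n) x = trans (cong (_+_ x) (∑-const n x)) (sym (ℤ.suc-* (+ n) x))

  ∑-neg : ∀ {n} (f : Fin n → ℤ) → ∑[ i < n ] (- f i) ≡ - sum f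
  ∑-neg {zero}  f = refl
  ∑-neg {suc n} f = trans (cong (_+_ (- f zero)) (∑-neg (f ∘ suc))) (sym (ℤ.neg-distrib-+ (f zero) _))

  ∑-distrib-minus : ∀ {n} (f g : Fin n → ℤ) → ∑[ i < n ] (f i - g i) ≡ sum f - sum g
  ∑-distrib-minus f g = trans (∑-distrib-+ f (-_ ∘ g)) (cong (_+_ (sum f)) (∑-neg g))

  ∑-mono-≤ : ∀ {n} {f g : Fin n → ℤ} → (∀ i → f i ≤ g i) → sum f ≤ sum g
  ∑-mono-≤ {zero}  f≤g = ℤ.≤-refl
  ∑-mono-≤ {suc n} f≤g = ℤ.+-mono-≤ (f≤g zero) (∑-mono-≤ (f≤g ∘ suc))

  ∑-nonNeg : ∀ {n} {f : Fin n → ℤ} → (∀ i → 0ℤ ≤ f i) → 0ℤ ≤ sum f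
  ∑-nonNeg {n} {f} 0≤f = subst (_≤ sum f) (trans (∑-const n 0ℤ) (ℤ.*-zeroʳ (+ n))) (∑-mono-≤ 0≤f)

  ∑-negative : ∀ {n} (f : Fin n → ℤ) → sum f < 0ℤ → ∃ λ i → f i < 0ℤ
  ∑-negative {zero}  f (ℤ.+<+ ())
  ∑-negative {suc n} f ∑f<0 with f zero ℤ.<? 0ℤ
  ... | yes f₀<0 = zero , f₀<0
  ... | no  f₀≮0 =
    let i , fᵢ<0 = ∑-negative (f ∘ suc) (ℤ.≤-<-trans tail≤∑f ∑f<0)
    in suc i , fᵢ<0
    where
    tail≤∑f : sum (f ∘ suc) ≤ sum f
    tail≤∑f = subst (_≤ sum f) (ℤ.+-identityˡ _) (ℤ.+-monoˡ-≤ (sum (f ∘ suc)) (ℤ.≮⇒≥ f₀≮0))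

  ∑-supported : ∀ {n} (f : Fin n → ℤ) (i : Fin n) → (∀ j → j ≢ i → f j ≡ 0ℤ) → sum f ≡ f i
  ∑-supported {suc n} f zero    f≡0 = begin
    f zero + sum (f ∘ suc)  ≡⟨ cong (_+_ (f zero)) (trans (sum-cong-≗ (λ j → f≡0 (suc j) λ ()))
                                                          (trans (∑-const n 0ℤ) (ℤ.*-zeroʳ (+ n)))) ⟩
    f zero + 0ℤ             ≡⟨ ℤ.+-identityʳ (f zero) ⟩
    f zero                  ∎
    where open ≡-Reasoning
  ∑-supported {suc n} f (suc i) f≡0 = begin
    f zero + sum (f ∘ suc)  ≡⟨ cong₂ _+_ (f≡0 zero λ ()) (∑-supported (f ∘ suc) i (λ j j≢i → f≡0 (suc j) (j≢i ∘ suc-injective))) ⟩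
    0ℤ + f (suc i)          ≡⟨ ℤ.+-identityˡ (f (suc i)) ⟩
    f (suc i)               ∎
    where open ≡-Reasoning

  ∑-select : ∀ {n} (i : Fin n) (g : Fin n → ℤ) → ∑[ j < n ] (𝟙 (i ≟ j) * g j) ≡ g i
  ∑-select i g = trans (∑-supported _ i (λ j j≢i → trans (cong (_* g j) (𝟙-no (i ≟ j) (j≢i ∘ sym))) (ℤ.*-zeroˡ (g j))))
                       (trans (cong (_* g i) (𝟙-yes (i ≟ i) refl)) (ℤ.*-identityˡ (g i)))

  ∑-𝟙-≟ : ∀ {n} (i : Fin n) → ∑[ j < n ] 𝟙 (i ≟ j) ≡ 1ℤ
  ∑-𝟙-≟ i = trans (sum-cong-≗ (λ j → sym (ℤ.*-identityʳ (𝟙 (i ≟ j))))) (∑-select i (λ _ → 1ℤ))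

  ∑-changeAt : ∀ {n} (f g : Fin n → ℤ) (i : Fin n) → (∀ j → j ≢ i → g j ≡ f j) → sum g ≡ sum f + (g i - f i)
  ∑-changeAt f g i g≡f = begin
    sum g                            ≡⟨ x≡y+[x-y] (sum g) (sum f) ⟩
    sum f + (sum g - sum f)          ≡⟨ cong (_+_ (sum f)) (sym (∑-distrib-minus g f)) ⟩
    sum f + ∑[ j < _ ] (g j - f j)   ≡⟨ cong (_+_ (sum f)) (∑-supported _ i λ j j≢i →
                                          trans (cong (_- f j) (g≡f j j≢i)) (ℤ.+-inverseʳ (f j))) ⟩
    sum f + (g i - f i)              ∎
    where
    open ≡-Reasoning
    x≡y+[x-y] : ∀ x y → x ≡ y + (x - y)
    x≡y+[x-y] = solve-∀

  ∑-involution : ∀ {n} (p : Fin n → Fin n) → (∀ i → p (p i) ≡ i) → (f : Fin n → ℤ) → ∑[ i < n ] f (p i) ≡ sum f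
  ∑-involution p p∘p≡id f = sym (sum-permute f (permutation p p p∘p≡id p∘p≡id))

  ∑-fibres : ∀ {m k} (w : Fin m → ℤ) (col : Fin m → Fin k) (h : Fin k → ℤ) →
             ∑[ x < m ] (w x * h (col x)) ≡ ∑[ i < k ] (h i * ∑[ x < m ] (w x * 𝟙 (col x ≟ i)))
  ∑-fibres {m} {k} w col h = begin
    ∑[ x < m ] (w x * h (col x))                        ≡⟨ sum-cong-≗ (λ x → cong (w x *_) (sym (∑-select (col x) h))) ⟩
    ∑[ x < m ] (w x * ∑[ i < k ] (𝟙 (col x ≟ i) * h i)) ≡⟨ sum-cong-≗ (λ x → *-distribˡ-sum {k} (w x) _) ⟩
    ∑[ x < m ] ∑[ i < k ] (w x * (𝟙 (col x ≟ i) * h i)) ≡⟨ sum-cong-≗ (λ x → sum-cong-≗ (λ i → rearrange (w x) _ (h i))) ⟩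
    ∑[ x < m ] ∑[ i < k ] (h i * (w x * 𝟙 (col x ≟ i))) ≡⟨ ∑-comm {m} {k} _ ⟩
    ∑[ i < k ] ∑[ x < m ] (h i * (w x * 𝟙 (col x ≟ i))) ≡⟨ sum-cong-≗ (λ i → sym (*-distribˡ-sum {m} (h i) _)) ⟩
    ∑[ i < k ] (h i * ∑[ x < m ] (w x * 𝟙 (col x ≟ i))) ∎
    where
    open ≡-Reasoning
    rearrange : ∀ a b c → a * (b * c) ≡ c * (a * b)
    rearrange = solve-∀

  -- Expand the nonnegative sum ∑ᵢ ∑ⱼ (aᵢ - aⱼ)², which equals 2 (n ∑ a² - (∑ a)²).
  cauchy-schwarz : ∀ {n} (a : Fin n → ℤ) → sum a * sum a ≤ + n * ∑[ i < n ] (a i * a i)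
  cauchy-schwarz {n} a = ℤ.0≤i-j⇒j≤i (half-nonNeg (subst (0ℤ ≤_) expand (∑-nonNeg λ i → ∑-nonNeg λ j → square-nonNeg (a i - a j))))
    where
    open ≡-Reasoning
    S = sum a
    Q = ∑[ i < n ] (a i * a i)
    half-nonNeg : ∀ {t} → 0ℤ ≤ + 2 * t → 0ℤ ≤ t
    half-nonNeg {+ _}      _  = ℤ.+≤+ ℕ.z≤n
    half-nonNeg {ℤ.-[1+ _ ]} ()
    square-diff : ∀ x y → (x - y) * (x - y) ≡ x * x + y * y - + 2 * (x * y)
    square-diff = solve-∀
    collect : ∀ n Q S → n * Q + n * Q - + 2 * (S * S) ≡ + 2 * (n * Q - S * S)
    collect = solve-∀
    inner : ∀ i → ∑[ j < n ] ((a i - a j) * (a i - a j)) ≡ + n * (a i * a i) + Q - + 2 * (a i * S)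
    inner i = begin
      ∑[ j < n ] ((a i - a j) * (a i - a j))                         ≡⟨ sum-cong-≗ (λ j → square-diff (a i) (a j)) ⟩
      ∑[ j < n ] (a i * a i + a j * a j - + 2 * (a i * a j))         ≡⟨ ∑-distrib-minus {n} _ _ ⟩
      ∑[ j < n ] (a i * a i + a j * a j) - ∑[ j < n ] (+ 2 * (a i * a j))
        ≡⟨ cong₂ _-_ (trans (∑-distrib-+ {n} _ _) (cong (_+ Q) (∑-const n (a i * a i))))
                     (trans (sym (*-distribˡ-sum {n} (+ 2) _)) (cong (+ 2 *_) (sym (*-distribˡ-sum (a i) a)))) ⟩
      + n * (a i * a i) + Q - + 2 * (a i * S)                        ∎
    expand : ∑[ i < n ] ∑[ j < n ] ((a i - a j) * (a i - a j)) ≡ + 2 * (+ n * Q - S * S)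
    expand = begin
      ∑[ i < n ] ∑[ j < n ] ((a i - a j) * (a i - a j))              ≡⟨ sum-cong-≗ inner ⟩
      ∑[ i < n ] (+ n * (a i * a i) + Q - + 2 * (a i * S))           ≡⟨ ∑-distrib-minus {n} _ _ ⟩
      ∑[ i < n ] (+ n * (a i * a i) + Q) - ∑[ i < n ] (+ 2 * (a i * S))
        ≡⟨ cong₂ _-_ (trans (∑-distrib-+ {n} _ _) (cong₂ _+_ (sym (*-distribˡ-sum {n} (+ n) _)) (∑-const n Q)))
                     (trans (sym (*-distribˡ-sum {n} (+ 2) _)) (cong (+ 2 *_) (sym (*-distribʳ-sum S a)))) ⟩
      + n * Q + + n * Q - + 2 * (S * S)                              ≡⟨ collect (+ n) Q S ⟩
      + 2 * (+ n * Q - S * S)                                        ∎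

  ∑∑-distrib-+ : ∀ {m n} (f g : Fin m → Fin n → ℤ) →
                 ∑[ u < m ] ∑[ v < n ] (f u v + g u v) ≡ ∑[ u < m ] ∑[ v < n ] f u v + ∑[ u < m ] ∑[ v < n ] g u v
  ∑∑-distrib-+ {m} {n} f g = trans (sum-cong-≗ (λ u → ∑-distrib-+ {n} (f u) (g u))) (∑-distrib-+ {m} _ _)

  ∑∑-distrib-minus : ∀ {m n} (f g : Fin m → Fin n → ℤ) →
                 ∑[ u < m ] ∑[ v < n ] (f u v - g u v) ≡ ∑[ u < m ] ∑[ v < n ] f u v - ∑[ u < m ] ∑[ v < n ] g u v
  ∑∑-distrib-minus {m} {n} f g = trans (sum-cong-≗ (λ u → ∑-distrib-minus {n} (f u) (g u))) (∑-distrib-minus {m} _ _)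

  ∑∑-*ˡ : ∀ {m n} (x : ℤ) (f : Fin m → Fin n → ℤ) → ∑[ u < m ] ∑[ v < n ] (x * f u v) ≡ x * ∑[ u < m ] ∑[ v < n ] f u v
  ∑∑-*ˡ {m} {n} x f = sym (trans (*-distribˡ-sum {m} x _) (sum-cong-≗ (λ u → *-distribˡ-sum {n} x (f u))))

  ∑≠ : ∀ {n} → (Fin n → Fin n → ℤ) → ℤ
  ∑≠ {n} g = ∑[ u < n ] ∑[ v < n ] ((1ℤ - 𝟙 (u ≟ v)) * g u v)

  module _ {n : ℕ} where

    ∑≠-distrib-+ : (f g : Fin n → Fin n → ℤ) → ∑≠ (λ u v → f u v + g u v) ≡ ∑≠ f + ∑≠ g
    ∑≠-distrib-+ f g = trans (sum-cong-≗ λ u → sum-cong-≗ λ v → ℤ.*-distribˡ-+ (1ℤ - 𝟙 (u ≟ v)) (f u v) (g u v))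
                             (∑∑-distrib-+ {n} {n} _ _)

    ∑≠-distrib-minus : (f g : Fin n → Fin n → ℤ) → ∑≠ (λ u v → f u v - g u v) ≡ ∑≠ f - ∑≠ g
    ∑≠-distrib-minus f g = trans (sum-cong-≗ λ u → sum-cong-≗ λ v → distrib (1ℤ - 𝟙 (u ≟ v)) (f u v) (g u v))
                                 (∑∑-distrib-minus {n} {n} _ _)
      where
      distrib : ∀ w x y → w * (x - y) ≡ w * x - w * y
      distrib = solve-∀

    ∑≠-*ˡ : (x : ℤ) (f : Fin n → Fin n → ℤ) → ∑≠ (λ u v → x * f u v) ≡ x * ∑≠ f
    ∑≠-*ˡ x f = trans (sum-cong-≗ λ u → sum-cong-≗ λ v → swap (1ℤ - 𝟙 (u ≟ v)) x (f u v)) (∑∑-*ˡ {n} {n} x _)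
      where
      swap : ∀ w x y → w * (x * y) ≡ x * (w * y)
      swap = solve-∀

    ∑≠-row : (u : Fin n) (g : Fin n → ℤ) → ∑[ v < n ] ((1ℤ - 𝟙 (u ≟ v)) * g v) ≡ sum g - g u
    ∑≠-row u g = begin
      ∑[ v < n ] ((1ℤ - 𝟙 (u ≟ v)) * g v)           ≡⟨ sum-cong-≗ (λ v → ℤ.*-distribʳ-+ (g v) 1ℤ (- 𝟙 (u ≟ v))) ⟩
      ∑[ v < n ] (1ℤ * g v + - 𝟙 (u ≟ v) * g v)     ≡⟨ sum-cong-≗ (λ v → cong₂ _+_ (ℤ.*-identityˡ (g v))
                                                                                 (sym (ℤ.neg-distribˡ-* (𝟙 (u ≟ v)) (g v)))) ⟩
      ∑[ v < n ] (g v - 𝟙 (u ≟ v) * g v)            ≡⟨ ∑-distrib-minus {n} g _ ⟩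
      sum g - ∑[ v < n ] (𝟙 (u ≟ v) * g v)          ≡⟨ cong (_-_ (sum g)) (∑-select u g) ⟩
      sum g - g u                                    ∎
      where open ≡-Reasoning

    ∑≠-fst : (φ : Fin n → ℤ) → ∑≠ (λ u v → φ u) ≡ (+ n - 1ℤ) * sum φ
    ∑≠-fst φ = begin
      ∑[ u < n ] ∑[ v < n ] ((1ℤ - 𝟙 (u ≟ v)) * φ u)  ≡⟨ sum-cong-≗ (λ u → ∑≠-row u (λ _ → φ u)) ⟩
      ∑[ u < n ] (∑[ v < n ] φ u - φ u)               ≡⟨ sum-cong-≗ (λ u → cong (_- φ u) (∑-const n (φ u))) ⟩
      ∑[ u < n ] (+ n * φ u - φ u)                     ≡⟨ sum-cong-≗ (λ u → factor (+ n) (φ u)) ⟩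
      ∑[ u < n ] ((+ n - 1ℤ) * φ u)                    ≡⟨ sym (*-distribˡ-sum {n} (+ n - 1ℤ) φ) ⟩
      (+ n - 1ℤ) * sum φ                               ∎
      where
      open ≡-Reasoning
      factor : ∀ m x → m * x - x ≡ (m - 1ℤ) * x
      factor = solve-∀

    ∑≠-transpose : (g : Fin n → Fin n → ℤ) → ∑≠ (λ u v → g v u) ≡ ∑≠ g
    ∑≠-transpose g = trans (∑-comm {n} {n} _) (sum-cong-≗ λ v → sum-cong-≗ λ u → cong (λ e → (1ℤ - e) * g v u) (𝟙-≟-sym u v))

    ∑≠-snd : (φ : Fin n → ℤ) → ∑≠ (λ u v → φ v) ≡ (+ n - 1ℤ) * sum φ
    ∑≠-snd φ = trans (∑≠-transpose (λ u v → φ u)) (∑≠-fst φ)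

    ∑≠-involution : (p : Fin n → Fin n) → (∀ u → p (p u) ≡ u) → (g : Fin n → Fin n → ℤ) →
                    ∑≠ (λ u v → g (p u) (p v)) ≡ ∑≠ g
    ∑≠-involution p p∘p≡id g = begin
      ∑[ u < n ] ∑[ v < n ] ((1ℤ - 𝟙 (u ≟ v)) * g (p u) (p v))
        ≡⟨ sum-cong-≗ (λ u → sum-cong-≗ λ v →
             cong (λ e → (1ℤ - e) * g (p u) (p v)) (𝟙-cong (u ≟ v) (p u ≟ p v) (cong p) p-injective)) ⟩
      ∑[ u < n ] ∑[ v < n ] ((1ℤ - 𝟙 (p u ≟ p v)) * g (p u) (p v))
        ≡⟨ sum-cong-≗ (λ u → ∑-involution p p∘p≡id (λ v → (1ℤ - 𝟙 (p u ≟ v)) * g (p u) v)) ⟩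
      ∑[ u < n ] ∑[ v < n ] ((1ℤ - 𝟙 (p u ≟ v)) * g (p u) v)
        ≡⟨ ∑-involution p p∘p≡id (λ u → ∑[ v < n ] ((1ℤ - 𝟙 (u ≟ v)) * g u v)) ⟩
      ∑≠ g ∎
      where
      open ≡-Reasoning
      p-injective : ∀ {x y} → p x ≡ p y → x ≡ y
      p-injective {x} {y} px≡py = trans (sym (p∘p≡id x)) (trans (cong p px≡py) (p∘p≡id y))

    ∑≠-negative : (g : Fin n → Fin n → ℤ) → ∑≠ g < 0ℤ → ∃₂ λ u v → u ≢ v × g u v < 0ℤ
    ∑≠-negative g ∑≠g<0 with ∑-negative _ ∑≠g<0
    ... | u , row<0 with ∑-negative _ row<0
    ... | v , term<0 = u , v , u≢v , g<0
      where
      weight≡ : ∀ {e} → 𝟙 (u ≟ v) ≡ e → (1ℤ - e) * g u v < 0ℤ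
      weight≡ 𝟙≡e = subst (λ e → (1ℤ - e) * g u v < 0ℤ) 𝟙≡e term<0
      u≢v : u ≢ v
      u≢v u≡v = ℤ.<-irrefl (sym (ℤ.*-zeroˡ (g u v))) (weight≡ (𝟙-yes (u ≟ v) u≡v))
      g<0 : g u v < 0ℤ
      g<0 = subst (_< 0ℤ) (ℤ.*-identityˡ (g u v)) (weight≡ (𝟙-no (u ≟ v) u≢v))

    ∑≠-fibres : ∀ {k} (col : Fin n → Fin n → Fin k) (h : Fin k → ℤ) →
                ∑≠ (λ u v → h (col u v)) ≡ ∑[ i < k ] (h i * ∑≠ (λ u v → 𝟙 (col u v ≟ i)))
    ∑≠-fibres {k} col h = begin
      ∑[ u < n ] ∑[ v < n ] ((1ℤ - 𝟙 (u ≟ v)) * h (col u v))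
        ≡⟨ sum-cong-≗ (λ u → ∑-fibres (λ v → 1ℤ - 𝟙 (u ≟ v)) (col u) h) ⟩
      ∑[ u < n ] ∑[ i < k ] (h i * ∑[ v < n ] ((1ℤ - 𝟙 (u ≟ v)) * 𝟙 (col u v ≟ i)))
        ≡⟨ ∑-comm {n} {k} _ ⟩
      ∑[ i < k ] ∑[ u < n ] (h i * ∑[ v < n ] ((1ℤ - 𝟙 (u ≟ v)) * 𝟙 (col u v ≟ i)))
        ≡⟨ sum-cong-≗ (λ i → sym (*-distribˡ-sum {n} (h i) _)) ⟩
      ∑[ i < k ] (h i * ∑≠ (λ u v → 𝟙 (col u v ≟ i))) ∎
      where open ≡-Reasoning

  𝟙-<-trichotomy : ∀ {n} (u v : Fin n) → 𝟙 (u <? v) + 𝟙 (v <? u) ≡ 1ℤ - 𝟙 (u ≟ v)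
  𝟙-<-trichotomy u v with <-cmp u v
  ... | tri< u<v u≢v v≮u rewrite 𝟙-yes (u <? v) u<v | 𝟙-no (v <? u) v≮u | 𝟙-no (u ≟ v) u≢v = refl
  ... | tri≈ u≮v u≡v v≮u rewrite 𝟙-no (u <? v) u≮v | 𝟙-no (v <? u) v≮u | 𝟙-yes (u ≟ v) u≡v = refl
  ... | tri> u≮v u≢v v<u rewrite 𝟙-no (u <? v) u≮v | 𝟙-yes (v <? u) v<u | 𝟙-no (u ≟ v) u≢v = refl

  ∑≠-symmetric : ∀ {n} (g : Fin n → Fin n → ℤ) → (∀ u v → g u v ≡ g v u) →
                 ∑≠ g ≡ + 2 * ∑[ u < n ] ∑[ v < n ] (𝟙 (u <? v) * g u v)
  ∑≠-symmetric {n} g g-sym = begin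
    ∑≠ g
      ≡⟨ sum-cong-≗ (λ u → sum-cong-≗ λ v →
           trans (cong (_* g u v) (sym (𝟙-<-trichotomy u v))) (ℤ.*-distribʳ-+ (g u v) (𝟙 (u <? v)) (𝟙 (v <? u)))) ⟩
    ∑[ u < n ] ∑[ v < n ] (𝟙 (u <? v) * g u v + 𝟙 (v <? u) * g u v)
      ≡⟨ ∑∑-distrib-+ {n} {n} _ _ ⟩
    S + ∑[ u < n ] ∑[ v < n ] (𝟙 (v <? u) * g u v)
      ≡⟨ cong (_+_ S) (trans (∑-comm {n} {n} _) (sum-cong-≗ λ v → sum-cong-≗ λ u → cong (𝟙 (v <? u) *_) (g-sym u v))) ⟩
    S + S
      ≡⟨ i+i≡2*i S ⟩
    + 2 * S ∎
    where
    open ≡-Reasoning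
    S = ∑[ u < n ] ∑[ v < n ] (𝟙 (u <? v) * g u v)

  ∑-involution-symmetric : ∀ {n} (p : Fin n → Fin n) → (∀ v → p (p v) ≡ v) → (∀ v → p v ≢ v) →
            (g : Fin n → Fin n → ℤ) → (∀ u v → g u v ≡ g v u) →
            ∑[ v < n ] g v (p v) ≡ + 2 * ∑[ v < n ] (𝟙 (v <? p v) * g v (p v))
  ∑-involution-symmetric {n} p p∘p≡id p-noFixed g g-sym = begin
    ∑[ v < n ] g v (p v)
      ≡⟨ sum-cong-≗ (λ v → trans (sym (ℤ.*-identityˡ _)) (cong (_* g v (p v)) (sym (𝟙<+𝟙>≡1 v)))) ⟩
    ∑[ v < n ] ((𝟙 (v <? p v) + 𝟙 (p v <? v)) * g v (p v))
      ≡⟨ trans (sum-cong-≗ λ v → ℤ.*-distribʳ-+ (g v (p v)) (𝟙 (v <? p v)) (𝟙 (p v <? v))) (∑-distrib-+ {n} _ _) ⟩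
    S + ∑[ v < n ] (𝟙 (p v <? v) * g v (p v))
      ≡⟨ cong (_+_ S) (sym (∑-involution p p∘p≡id (λ v → 𝟙 (p v <? v) * g v (p v)))) ⟩
    S + ∑[ v < n ] (𝟙 (p (p v) <? p v) * g (p v) (p (p v)))
      ≡⟨ cong (_+_ S) (sum-cong-≗ λ v →
           trans (cong (λ w → 𝟙 (w <? p v) * g (p v) w) (p∘p≡id v)) (cong (𝟙 (v <? p v) *_) (g-sym (p v) v))) ⟩
    S + S
      ≡⟨ i+i≡2*i S ⟩
    + 2 * S ∎
    where
    open ≡-Reasoning
    S = ∑[ v < n ] (𝟙 (v <? p v) * g v (p v))
    𝟙<+𝟙>≡1 : ∀ v → 𝟙 (v <? p v) + 𝟙 (p v <? v) ≡ 1ℤ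
    𝟙<+𝟙>≡1 v = trans (𝟙-<-trichotomy v (p v)) (cong (_-_ 1ℤ) (𝟙-no (v ≟ p v) (p-noFixed v ∘ sym)))

  listSum : (A → ℤ) → List A → ℤ
  listSum f []       = 0ℤ
  listSum f (x ∷ xs) = f x + listSum f xs

  length-filter : (P? : Decidable P) (xs : List A) → + length (filter P? xs) ≡ listSum (𝟙 ∘ P?) xs
  length-filter P? []       = refl
  length-filter P? (x ∷ xs) with P? x
  ... | yes _ = cong (_+_ 1ℤ) (length-filter P? xs)
  ... | no  _ = trans (length-filter P? xs) (sym (ℤ.+-identityˡ _))

  listSum-filter : (P? : Decidable P) (f : A → ℤ) (xs : List A) →
                   listSum f (filter P? xs) ≡ listSum (λ x → 𝟙 (P? x) * f x) xs
  listSum-filter P? f []       = refl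
  listSum-filter P? f (x ∷ xs) with P? x
  ... | yes _ = cong₂ _+_ (sym (ℤ.*-identityˡ (f x))) (listSum-filter P? f xs)
  ... | no  _ = trans (listSum-filter P? f xs) (sym (ℤ.+-identityˡ _))

  listSum-++ : (f : A → ℤ) (xs ys : List A) → listSum f (xs ++ ys) ≡ listSum f xs + listSum f ys
  listSum-++ f []       ys = sym (ℤ.+-identityˡ _)
  listSum-++ f (x ∷ xs) ys = trans (cong (_+_ (f x)) (listSum-++ f xs ys)) (sym (ℤ.+-assoc (f x) _ _))

  listSum-map : (f : B → ℤ) (g : A → B) (xs : List A) → listSum f (map g xs) ≡ listSum (f ∘ g) xs
  listSum-map f g []       = refl
  listSum-map f g (x ∷ xs) = cong (_+_ (f (g x))) (listSum-map f g xs)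

  listSum-concatMap : (f : B → ℤ) (g : A → List B) (xs : List A) →
                      listSum f (concatMap g xs) ≡ listSum (listSum f ∘ g) xs
  listSum-concatMap f g []       = refl
  listSum-concatMap f g (x ∷ xs) = trans (listSum-++ f (g x) (concatMap g xs)) (cong (_+_ (listSum f (g x))) (listSum-concatMap f g xs))

  listSum-natSum : (f : A → ℕ) (xs : List A) → + ℕ.sum (map f xs) ≡ listSum (+_ ∘ f) xs
  listSum-natSum f []       = refl
  listSum-natSum f (x ∷ xs) = trans (ℤ.pos-+ (f x) _) (cong (_+_ (+ f x)) (listSum-natSum f xs))

  listSum-tabulate : ∀ n (f : A → ℤ) (g : Fin n → A) → listSum f (tabulate g) ≡ ∑[ i < n ] f (g i)
  listSum-tabulate zero    f g = refl
  listSum-tabulate (suc n) f g = cong (_+_ (f (g zero))) (listSum-tabulate n f (g ∘ suc))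

  listSum-allFin-map : ∀ n (f : A → ℤ) (g : Fin n → A) → listSum f (map g (allFin n)) ≡ ∑[ i < n ] f (g i)
  listSum-allFin-map n f g = trans (listSum-map f g (allFin n)) (listSum-tabulate n (f ∘ g) id)

  listSum-allPairs : ∀ N (f : Fin N × Fin N → ℤ) → listSum f (allPairs N) ≡ ∑[ u < N ] ∑[ v < N ] f (u , v)
  listSum-allPairs N f = trans (listSum-concatMap f _ (allFin N))
                        (trans (listSum-tabulate N _ id) (sum-cong-≗ λ u → listSum-allFin-map N f (u ,_)))

  exchangeVector : ∀ {k} (a b c d : Fin k) → Fin k → ℤ
  exchangeVector a b c d i = 𝟙 (a ≟ i) + 𝟙 (b ≟ i) - 𝟙 (c ≟ i) - 𝟙 (d ≟ i)

  module _ {k} (a b c d : Fin k) where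

    ∑-exchangeVector-* : (D : Fin k → ℤ) → ∑[ i < k ] (exchangeVector a b c d i * D i) ≡ D a + D b - D c - D d
    ∑-exchangeVector-* D = begin
      ∑[ i < k ] (exchangeVector a b c d i * D i)
        ≡⟨ sum-cong-≗ (λ i → distrib (𝟙 (a ≟ i)) (𝟙 (b ≟ i)) (𝟙 (c ≟ i)) (𝟙 (d ≟ i)) (D i)) ⟩
      ∑[ i < k ] (𝟙 (a ≟ i) * D i + 𝟙 (b ≟ i) * D i - 𝟙 (c ≟ i) * D i - 𝟙 (d ≟ i) * D i)
        ≡⟨ trans (∑-distrib-minus {k} _ _) (cong (_- _) (trans (∑-distrib-minus {k} _ _) (cong (_- _) (∑-distrib-+ {k} _ _)))) ⟩
      ∑[ i < k ] (𝟙 (a ≟ i) * D i) + ∑[ i < k ] (𝟙 (b ≟ i) * D i) - ∑[ i < k ] (𝟙 (c ≟ i) * D i) - ∑[ i < k ] (𝟙 (d ≟ i) * D i)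
        ≡⟨ cong₂ _-_ (cong₂ _-_ (cong₂ _+_ (∑-select a D) (∑-select b D)) (∑-select c D)) (∑-select d D) ⟩
      D a + D b - D c - D d ∎
      where
      open ≡-Reasoning
      distrib : ∀ w x y z t → (w + x - y - z) * t ≡ w * t + x * t - y * t - z * t
      distrib = solve-∀

    ∑-exchangeVector-square-≤ : ∑[ i < k ] (exchangeVector a b c d i * exchangeVector a b c d i) ≤ + 8
    ∑-exchangeVector-square-≤ = begin
      ∑[ i < k ] (E i * E i)
        ≡⟨ sum-cong-≗ (λ i → cong (λ x → x * x) (regroup (𝟙 (a ≟ i)) (𝟙 (b ≟ i)) (𝟙 (c ≟ i)) (𝟙 (d ≟ i)))) ⟩
      ∑[ i < k ] ((α i + β i) * (α i + β i))
        ≤⟨ ∑-mono-≤ (λ i → ℤ.≤-trans (square-+-≤ (α i) (β i))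
                            (ℤ.+-mono-≤ (ℤ.*-monoˡ-≤-nonNeg (+ 2) (𝟙-diff-square-≤ (a ≟ i) (c ≟ i)))
                                        (ℤ.*-monoˡ-≤-nonNeg (+ 2) (𝟙-diff-square-≤ (b ≟ i) (d ≟ i))))) ⟩
      ∑[ i < k ] (+ 2 * (𝟙 (a ≟ i) + 𝟙 (c ≟ i)) + + 2 * (𝟙 (b ≟ i) + 𝟙 (d ≟ i)))
        ≡⟨ trans (∑-distrib-+ {k} _ _) (cong₂ _+_ (trans (sym (*-distribˡ-sum {k} (+ 2) _)) (cong (+ 2 *_) (pair a c)))
                                                  (trans (sym (*-distribˡ-sum {k} (+ 2) _)) (cong (+ 2 *_) (pair b d)))) ⟩
      + 8 ∎
      where
      open ℤ.≤-Reasoning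
      E = exchangeVector a b c d
      α β : Fin k → ℤ
      α i = 𝟙 (a ≟ i) - 𝟙 (c ≟ i)
      β i = 𝟙 (b ≟ i) - 𝟙 (d ≟ i)
      regroup : ∀ w x y z → w + x - y - z ≡ (w - y) + (x - z)
      regroup = solve-∀
      pair : ∀ x y → ∑[ i < k ] (𝟙 (x ≟ i) + 𝟙 (y ≟ i)) ≡ + 2
      pair x y = trans (∑-distrib-+ {k} _ _) (cong₂ _+_ (∑-𝟙-≟ x) (∑-𝟙-≟ y))

  ∑-square-exchange-≤ : ∀ {k} (D : Fin k → ℤ) (a b c d : Fin k) →
                        ∑[ i < k ] ((D i + + 2 * exchangeVector a b c d i) * (D i + + 2 * exchangeVector a b c d i))
                          ≤ ∑[ i < k ] (D i * D i) + + 4 * (D a + D b - D c - D d) + + 32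
  ∑-square-exchange-≤ {k} D a b c d = begin
    ∑[ i < k ] ((D i + + 2 * E i) * (D i + + 2 * E i))
      ≡⟨ sum-cong-≗ (λ i → expand (D i) (E i)) ⟩
    ∑[ i < k ] (D i * D i + + 4 * (E i * D i) + + 4 * (E i * E i))
      ≡⟨ trans (∑-distrib-+ {k} (λ i → D i * D i + + 4 * (E i * D i)) (λ i → + 4 * (E i * E i)))
               (cong₂ _+_ (trans (∑-distrib-+ {k} (λ i → D i * D i) (λ i → + 4 * (E i * D i)))
                                 (cong (_+_ (∑[ i < k ] (D i * D i))) (sym (*-distribˡ-sum {k} (+ 4) (λ i → E i * D i)))))
                          (sym (*-distribˡ-sum {k} (+ 4) (λ i → E i * E i)))) ⟩
    ∑[ i < k ] (D i * D i) + + 4 * ∑[ i < k ] (E i * D i) + + 4 * ∑[ i < k ] (E i * E i)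
      ≤⟨ ℤ.+-monoʳ-≤ (∑[ i < k ] (D i * D i) + + 4 * ∑[ i < k ] (E i * D i))
                     (ℤ.*-monoˡ-≤-nonNeg (+ 4) (∑-exchangeVector-square-≤ a b c d)) ⟩
    ∑[ i < k ] (D i * D i) + + 4 * ∑[ i < k ] (E i * D i) + + 32
      ≡⟨ cong (λ x → ∑[ i < k ] (D i * D i) + + 4 * x + + 32) (∑-exchangeVector-* a b c d D) ⟩
    ∑[ i < k ] (D i * D i) + + 4 * (D a + D b - D c - D d) + + 32 ∎
    where
    open ℤ.≤-Reasoning
    E = exchangeVector a b c d
    expand : ∀ x e → (x + + 2 * e) * (x + + 2 * e) ≡ x * x + + 4 * (e * x) + + 4 * (e * e)
    expand = solve-∀

  descent : (Φ : A → ℤ) (t : ℤ) → (∀ x → 0ℤ ≤ Φ x) → (∀ x → t < Φ x → ∃ λ y → Φ y < Φ x) → A → ∃ λ y → Φ y ≤ t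
  descent Φ t Φ≥0 improve x = go x (ℕ.<-wellFounded ∣ Φ x ∣)
    where
    ∣Φ∣-mono-< : ∀ {x y} → Φ y < Φ x → ∣ Φ y ∣ ℕ.< ∣ Φ x ∣
    ∣Φ∣-mono-< {x} {y} = ℤ.drop‿+<+ ∘ subst₂ _<_ (sym (ℤ.0≤i⇒+∣i∣≡i (Φ≥0 y))) (sym (ℤ.0≤i⇒+∣i∣≡i (Φ≥0 x)))
    go : ∀ x → Acc ℕ._<_ ∣ Φ x ∣ → ∃ λ y → Φ y ≤ t
    go x (acc rs) with Φ x ℤ.≤? t
    ... | yes Φx≤t = x , Φx≤t
    ... | no  Φx≰t = let y , Φy<Φx = improve x (ℤ.≰⇒> Φx≰t) in go y (rs (∣Φ∣-mono-< Φy<Φx))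

  halvesMatching : ∀ m → PerfectMatching (m ℕ.+ m)
  halvesMatching m = record { partner = opposite ; involutive = opposite-involutive ; noFixed = opposite-noFixed }
    where
    opposite : Fin (m ℕ.+ m) → Fin (m ℕ.+ m)
    opposite = join m m ∘ Sum.swap ∘ splitAt m
    splitAt-opposite : ∀ v → splitAt m (opposite v) ≡ Sum.swap (splitAt m v)
    splitAt-opposite v = splitAt-join m m (Sum.swap (splitAt m v))
    opposite-involutive : ∀ v → opposite (opposite v) ≡ v
    opposite-involutive v = trans (cong (join m m ∘ Sum.swap) (splitAt-opposite v))
                                  (trans (cong (join m m) (Sum.swap-involutive (splitAt m v))) (join-splitAt m m v))
    swap-noFixed : ∀ (s : Fin m ⊎ Fin m) → Sum.swap s ≢ s
    swap-noFixed (inj₁ _) ()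
    swap-noFixed (inj₂ _) ()
    opposite-noFixed : ∀ v → opposite v ≢ v
    opposite-noFixed v opposite≡v = swap-noFixed (splitAt m v) (trans (sym (splitAt-opposite v)) (cong (splitAt m) opposite≡v))

  evenMatching : ∀ m → PerfectMatching (2 ℕ.* m)
  evenMatching m = subst PerfectMatching (cong (m ℕ.+_) (sym (ℕ.+-identityʳ m))) (halvesMatching m)

  infixl 9 _[_≔_]
  _[_≔_] : ∀ {n} → (Fin n → Fin n) → Fin n → Fin n → (Fin n → Fin n)
  q [ a ≔ b ] = updateAt q a (const b)

  module _ {n} (q : Fin n → Fin n) (a b : Fin n) where

    ≔-self : (q [ a ≔ b ]) a ≡ b
    ≔-self = updateAt-updates a q

    ≔-other : ∀ {w} → w ≢ a → (q [ a ≔ b ]) w ≡ q w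
    ≔-other w≢a = updateAt-minimal _ a q w≢a

  partner-injective : ∀ {N} (M : PerfectMatching N) {u v} → partner M u ≡ partner M v → u ≡ v
  partner-injective M {u} {v} pu≡pv = trans (sym (involutive M u)) (trans (cong (partner M) pu≡pv) (involutive M v))

  partner-transpose : ∀ {N} (M : PerfectMatching N) {u v} → partner M u ≡ v → u ≡ partner M v
  partner-transpose M {u} pu≡v = trans (sym (involutive M u)) (cong (partner M) pu≡v)

  -- Replace the edges {u, p u} and {v, p v} of M by {u, v} and {p u, p v}.
  module Switch {N} (M : PerfectMatching N) {u v : Fin N} (u≢v : u ≢ v) (v≢pu : v ≢ partner M u) where

    p : Fin N → Fin N
    p = partner M

    u≢pu : u ≢ p u
    u≢pu = noFixed M u ∘ sym
    v≢pv : v ≢ p v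
    v≢pv = noFixed M v ∘ sym
    u≢pv : u ≢ p v
    u≢pv = v≢pu ∘ partner-transpose M ∘ sym
    pu≢pv : p u ≢ p v
    pu≢pv = u≢v ∘ partner-injective M

    switched : Fin N → Fin N
    switched = p [ p v ≔ p u ] [ p u ≔ p v ] [ v ≔ u ] [ u ≔ v ]

    switched-u : switched u ≡ v
    switched-u = ≔-self _ u v
    switched-v : switched v ≡ u
    switched-v = trans (≔-other _ u v (u≢v ∘ sym)) (≔-self _ v u)
    switched-pu : switched (p u) ≡ p v
    switched-pu = trans (≔-other _ u v (u≢pu ∘ sym)) (trans (≔-other _ v u (v≢pu ∘ sym)) (≔-self _ (p u) (p v)))
    switched-pv : switched (p v) ≡ p u
    switched-pv = trans (≔-other _ u v (u≢pv ∘ sym)) (trans (≔-other _ v u (v≢pv ∘ sym))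
                    (trans (≔-other _ (p u) (p v) (pu≢pv ∘ sym)) (≔-self _ (p v) (p u))))
    switched-other : ∀ {w} → w ≢ u → w ≢ v → w ≢ p u → w ≢ p v → switched w ≡ p w
    switched-other w≢u w≢v w≢pu w≢pv =
      trans (≔-other _ u v w≢u) (trans (≔-other _ v u w≢v) (trans (≔-other _ (p u) (p v) w≢pu) (≔-other _ (p v) (p u) w≢pv)))

    switched-involutive : ∀ w → switched (switched w) ≡ w
    switched-involutive w with w ≟ u | w ≟ v | w ≟ p u | w ≟ p v
    ... | yes refl | _ | _ | _ = trans (cong switched switched-u) switched-v
    ... | no _ | yes refl | _ | _ = trans (cong switched switched-v) switched-u
    ... | no _ | no _ | yes refl | _ = trans (cong switched switched-pu) switched-pv
    ... | no _ | no _ | no _ | yes refl = trans (cong switched switched-pv) switched-pu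
    ... | no w≢u | no w≢v | no w≢pu | no w≢pv =
      trans (cong switched (switched-other w≢u w≢v w≢pu w≢pv))
            (trans (switched-other (w≢pu ∘ partner-transpose M) (w≢pv ∘ partner-transpose M)
                                   (w≢u ∘ partner-injective M) (w≢v ∘ partner-injective M))
                   (involutive M w))

    switched-noFixed : ∀ w → switched w ≢ w
    switched-noFixed w with w ≟ u | w ≟ v | w ≟ p u | w ≟ p v
    ... | yes refl | _ | _ | _ = u≢v ∘ sym ∘ trans (sym switched-u)
    ... | no _ | yes refl | _ | _ = u≢v ∘ trans (sym switched-v)
    ... | no _ | no _ | yes refl | _ = pu≢pv ∘ sym ∘ trans (sym switched-pu)
    ... | no _ | no _ | no _ | yes refl = pu≢pv ∘ trans (sym switched-pv)
    ... | no w≢u | no w≢v | no w≢pu | no w≢pv = noFixed M w ∘ trans (sym (switched-other w≢u w≢v w≢pu w≢pv))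

    switchedMatching : PerfectMatching N
    switchedMatching = record { partner = switched ; involutive = switched-involutive ; noFixed = switched-noFixed }

  module _ {N k : ℕ} (c : EdgeColouring N k) where

    𝟙-col-sym : ∀ u v i → 𝟙 (col c u v ≟ i) ≡ 𝟙 (col c v u ≟ i)
    𝟙-col-sym u v i = cong (λ j → 𝟙 (j ≟ i)) (EdgeColouring.sym c u v)

    colourClassSize-∑ : ∀ i → + colourClassSize c i ≡ ∑[ u < N ] ∑[ v < N ] (𝟙 (u <? v) * 𝟙 (col c u v ≟ i))
    colourClassSize-∑ i = trans (length-filter _ (edges N)) (trans (listSum-filter _ _ (allPairs N)) (listSum-allPairs N _))

    colourCountIn-∑ : ∀ M i → + colourCountIn c M i ≡ ∑[ v < N ] (𝟙 (v <? partner M v) * 𝟙 (col c v (partner M v) ≟ i))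
    colourCountIn-∑ M i = trans (length-filter _ (matchingEdges M)) (trans (listSum-filter _ _ (map _ (allFin N))) (listSum-allFin-map N _ _))

    -- twice the number of edges {w, q w} of colour i when q is a perfect matching
    incidence : (Fin N → Fin N) → Fin k → ℤ
    incidence q i = ∑[ w < N ] 𝟙 (col c w (q w) ≟ i)

    incidence-matching : ∀ M i → incidence (partner M) i ≡ + 2 * + colourCountIn c M i
    incidence-matching M i = trans (∑-involution-symmetric (partner M) (involutive M) (noFixed M)
                                                           (λ u v → 𝟙 (col c u v ≟ i)) (λ u v → 𝟙-col-sym u v i))
                                   (cong (+ 2 *_) (sym (colourCountIn-∑ M i)))

    ∑-incidence : ∀ q → ∑[ i < k ] incidence q i ≡ + N
    ∑-incidence q = begin
      ∑[ i < k ] ∑[ w < N ] 𝟙 (col c w (q w) ≟ i) ≡⟨ ∑-comm {k} {N} _ ⟩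
      ∑[ w < N ] ∑[ i < k ] 𝟙 (col c w (q w) ≟ i) ≡⟨ sum-cong-≗ (λ w → ∑-𝟙-≟ (col c w (q w))) ⟩
      ∑[ w < N ] 1ℤ                               ≡⟨ trans (∑-const N 1ℤ) (ℤ.*-identityʳ (+ N)) ⟩
      + N                                         ∎
      where open ≡-Reasoning

    incidence-update : ∀ q a b i → incidence (q [ a ≔ b ]) i ≡ incidence q i + (𝟙 (col c a b ≟ i) - 𝟙 (col c a (q a) ≟ i))
    incidence-update q a b i =
      trans (∑-changeAt _ _ a λ w w≢a → cong (λ x → 𝟙 (col c w x ≟ i)) (≔-other q a b w≢a))
            (cong (λ x → incidence q i + (𝟙 (col c a x ≟ i) - 𝟙 (col c a (q a) ≟ i))) (≔-self q a b))

    module _ (M : PerfectMatching N) {u v : Fin N} (u≢v : u ≢ v) (v≢pu : v ≢ partner M u) where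
      open Switch M u≢v v≢pu

      switchExchange : Fin k → ℤ
      switchExchange = exchangeVector (col c u v) (col c (p u) (p v)) (col c u (p u)) (col c v (p v))

      incidence-switched : ∀ i → incidence switched i ≡ incidence p i + + 2 * switchExchange i
      incidence-switched i = begin
        incidence (q₃ [ u ≔ v ]) i
          ≡⟨ step q₃ u v (p u) q₃u≡pu ⟩
        incidence q₃ i + (χ u v - χ u (p u))
          ≡⟨ cong (_+ (χ u v - χ u (p u))) (step q₂ v u (p v) q₂v≡pv) ⟩
        incidence q₂ i + (χ v u - χ v (p v)) + (χ u v - χ u (p u))
          ≡⟨ cong (λ t → t + (χ v u - χ v (p v)) + (χ u v - χ u (p u))) (step q₁ (p u) (p v) u q₁pu≡u) ⟩
        incidence q₁ i + (χ (p u) (p v) - χ (p u) u) + (χ v u - χ v (p v)) + (χ u v - χ u (p u))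
          ≡⟨ cong (λ t → t + (χ (p u) (p v) - χ (p u) u) + (χ v u - χ v (p v)) + (χ u v - χ u (p u))) (step p (p v) (p u) v (involutive M v)) ⟩
        incidence p i + (χ (p v) (p u) - χ (p v) v) + (χ (p u) (p v) - χ (p u) u) + (χ v u - χ v (p v)) + (χ u v - χ u (p u))
          ≡⟨ collect {incidence p i} (𝟙-col-sym v u i) (𝟙-col-sym (p v) (p u) i) (𝟙-col-sym (p u) u i) (𝟙-col-sym (p v) v i) ⟩
        incidence p i + + 2 * switchExchange i ∎
        where
        open ≡-Reasoning
        χ : Fin N → Fin N → ℤ
        χ x y = 𝟙 (col c x y ≟ i)
        q₁ q₂ q₃ : Fin N → Fin N
        q₁ = p [ p v ≔ p u ]
        q₂ = q₁ [ p u ≔ p v ]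
        q₃ = q₂ [ v ≔ u ]
        q₁pu≡u : q₁ (p u) ≡ u
        q₁pu≡u = trans (≔-other p (p v) (p u) pu≢pv) (involutive M u)
        q₂v≡pv : q₂ v ≡ p v
        q₂v≡pv = trans (≔-other q₁ (p u) (p v) v≢pu) (≔-other p (p v) (p u) v≢pv)
        q₃u≡pu : q₃ u ≡ p u
        q₃u≡pu = trans (≔-other q₂ v u u≢v) (trans (≔-other q₁ (p u) (p v) u≢pu) (≔-other p (p v) (p u) u≢pv))
        step : ∀ q a b b′ → q a ≡ b′ → incidence (q [ a ≔ b ]) i ≡ incidence q i + (χ a b - χ a b′)
        step q a b b′ qa≡b′ = trans (incidence-update q a b i) (cong (λ x → incidence q i + (χ a b - χ a x)) qa≡b′)
        collect : ∀ {X a a′ b b′ c c′ d d′} → a′ ≡ a → b′ ≡ b → c′ ≡ c → d′ ≡ d →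
                  X + (b′ - d′) + (b - c′) + (a′ - d) + (a - c) ≡ X + + 2 * (a + b - c - d)
        collect {X} {a} {b = b} {c = c} {d = d} refl refl refl refl = regroup X a b c d
          where
          regroup : ∀ X a b c d → X + (b - d) + (b - c) + (a - d) + (a - c) ≡ X + + 2 * (a + b - c - d)
          regroup = solve-∀

    module _ (n : ℕ) where

      excess : PerfectMatching N → Fin k → ℤ
      excess M i = incidence (partner M) i - + 2 * + n

      imbalance : PerfectMatching N → ℤ
      imbalance M = ∑[ i < k ] (excess M i * excess M i)

      imbalance-nonNeg : ∀ M → 0ℤ ≤ imbalance M
      imbalance-nonNeg M = ∑-nonNeg (λ i → square-nonNeg (excess M i))

      -- first-order change of the imbalance when {u, p u}, {v, p v} are switched to {u, v}, {p u, p v}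
      gain : PerfectMatching N → Fin N → Fin N → ℤ
      gain M u v = excess M (col c u v) + excess M (col c (p u) (p v)) - excess M (col c u (p u)) - excess M (col c v (p v))
        where p = partner M

      gain-partner : ∀ M u → gain M u (partner M u) ≡ 0ℤ
      gain-partner M u = begin
        e (col c u (p u)) + e (col c (p u) (p (p u))) - e (col c u (p u)) - e (col c (p u) (p (p u)))
          ≡⟨ cancel (e (col c u (p u))) (e (col c (p u) (p (p u)))) ⟩
        0ℤ ∎
        where
        open ≡-Reasoning
        p = partner M
        e = excess M
        cancel : ∀ x y → x + y - x - y ≡ 0ℤ
        cancel = solve-∀

      imbalance-switched-≤ : ∀ M {u v} (u≢v : u ≢ v) (v≢pu : v ≢ partner M u) →
                             imbalance (Switch.switchedMatching M u≢v v≢pu) ≤ imbalance M + (+ 4 * gain M u v + + 32)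
      imbalance-switched-≤ M {u} {v} u≢v v≢pu = begin
        imbalance (Switch.switchedMatching M u≢v v≢pu)
          ≡⟨ sum-cong-≗ (λ i → cong (λ x → x * x) (shift i)) ⟩
        ∑[ i < k ] ((excess M i + + 2 * E i) * (excess M i + + 2 * E i))
          ≤⟨ ∑-square-exchange-≤ (excess M) (col c u v) (col c (p u) (p v)) (col c u (p u)) (col c v (p v)) ⟩
        imbalance M + + 4 * gain M u v + + 32
          ≡⟨ ℤ.+-assoc (imbalance M) _ _ ⟩
        imbalance M + (+ 4 * gain M u v + + 32) ∎
        where
        open ℤ.≤-Reasoning
        p = partner M
        E = switchExchange M u≢v v≢pu
        shift : ∀ i → excess (Switch.switchedMatching M u≢v v≢pu) i ≡ excess M i + + 2 * E i
        shift i = trans (cong (_- + 2 * + n) (incidence-switched M u≢v v≢pu i)) (swap-terms (incidence p i) _ _)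
          where
          swap-terms : ∀ x y z → x + y - z ≡ x - z + y
          swap-terms = solve-∀

      excess-matching : ∀ M i → excess M i ≡ + 2 * (+ colourCountIn c M i - + n)
      excess-matching M i = trans (cong (_- + 2 * + n) (incidence-matching M i)) (factor (+ colourCountIn c M i) (+ n))
        where
        factor : ∀ a b → + 2 * a - + 2 * b ≡ + 2 * (a - b)
        factor = solve-∀

      imbalance-matching : ∀ M → imbalance M ≡ + 4 * ∑[ i < k ] ((+ colourCountIn c M i - + n) * (+ colourCountIn c M i - + n))
      imbalance-matching M = trans (sum-cong-≗ λ i → trans (cong (λ e → e * e) (excess-matching M i)) (square-double (y i)))
                                   (sym (*-distribˡ-sum {k} (+ 4) (λ i → y i * y i)))
        where
        y : Fin k → ℤ
        y i = + colourCountIn c M i - + n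
        square-double : ∀ a → + 2 * a * (+ 2 * a) ≡ + 4 * (a * a)
        square-double = solve-∀

      fM-∑ : ∀ M → + fM c n M ≡ ∑[ i < k ] (+ ℕ.∣ colourCountIn c M i - n ∣)
      fM-∑ M = trans (listSum-natSum _ (allFin k)) (listSum-tabulate k _ id)

      module _ (N≡2kn : N ≡ 2 ℕ.* k ℕ.* n) where

        ∑-excess : ∀ M → sum (excess M) ≡ 0ℤ
        ∑-excess M = begin
          ∑[ i < k ] (incidence (partner M) i - + 2 * + n)            ≡⟨ ∑-distrib-minus {k} _ _ ⟩
          ∑[ i < k ] incidence (partner M) i - ∑[ i < k ] (+ 2 * + n)  ≡⟨ cong₂ _-_ (∑-incidence (partner M)) (∑-const k (+ 2 * + n)) ⟩
          + N - + k * (+ 2 * + n)                                       ≡⟨ cong (_- + k * (+ 2 * + n)) +N≡k*2n ⟩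
          + k * (+ 2 * + n) - + k * (+ 2 * + n)                         ≡⟨ ℤ.+-inverseʳ (+ k * (+ 2 * + n)) ⟩
          0ℤ                                                            ∎
          where
          open ≡-Reasoning
          +2kn : ∀ k n → + 2 * k * n ≡ k * (+ 2 * n)
          +2kn = solve-∀
          +N≡k*2n : + N ≡ + k * (+ 2 * + n)
          +N≡k*2n = trans (cong +_ N≡2kn) (trans (ℤ.pos-* (2 ℕ.* k) n) (trans (cong (_* + n) (ℤ.pos-* 2 k)) (+2kn (+ k) (+ n))))

        ∑-excess-partner : ∀ M → ∑[ w < N ] excess M (col c w (partner M w)) ≡ imbalance M
        ∑-excess-partner M = begin
          ∑[ w < N ] e (col c w (p w))                                   ≡⟨ sum-cong-≗ (λ w → sym (ℤ.*-identityˡ (e (col c w (p w))))) ⟩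
          ∑[ w < N ] (1ℤ * e (col c w (p w)))                            ≡⟨ ∑-fibres (λ _ → 1ℤ) (λ w → col c w (p w)) e ⟩
          ∑[ i < k ] (e i * ∑[ w < N ] (1ℤ * 𝟙 (col c w (p w) ≟ i)))   ≡⟨ sum-cong-≗ (λ i → cong (e i *_)
                                                                              (sum-cong-≗ λ w → ℤ.*-identityˡ (𝟙 (col c w (p w) ≟ i)))) ⟩
          ∑[ i < k ] (e i * incidence p i)                             ≡⟨ sum-cong-≗ (λ i → split (incidence p i) (+ 2 * + n)) ⟩
          ∑[ i < k ] (e i * e i + e i * (+ 2 * + n))                     ≡⟨ ∑-distrib-+ {k} _ _ ⟩
          imbalance M + ∑[ i < k ] (e i * (+ 2 * + n))                   ≡⟨ cong (_+_ (imbalance M)) (sym (*-distribʳ-sum {k} (+ 2 * + n) e)) ⟩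
          imbalance M + sum e * (+ 2 * + n)                              ≡⟨ cong (λ s → imbalance M + s * (+ 2 * + n)) (∑-excess M) ⟩
          imbalance M + 0ℤ                                               ≡⟨ ℤ.+-identityʳ (imbalance M) ⟩
          imbalance M                                                    ∎
          where
          open ≡-Reasoning
          p = partner M
          e = excess M
          split : ∀ x t → (x - t) * x ≡ (x - t) * (x - t) + (x - t) * t
          split = solve-∀

        fM-bound : ∀ M → imbalance M ≤ + 4 * + N → fM c n M ℕ.^ 2 ℕ.≤ 2 ℕ.* n ℕ.* k ℕ.^ 2
        fM-bound M Ψ≤4N = ℤ.drop‿+≤+ (subst₂ _≤_ (sym +f²≡) (sym +2nk²≡) (begin
          + f * + f                        ≡⟨ cong (λ s → s * s) (fM-∑ M) ⟩
          sum ∣y∣ * sum ∣y∣                ≤⟨ cauchy-schwarz ∣y∣ ⟩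
          + k * ∑[ i < k ] (∣y∣ i * ∣y∣ i)  ≡⟨ cong (+ k *_) (sum-cong-≗ λ i →
                                                trans (cong (λ a → + a * + a) (∣m-n∣≡∣+m-+n∣ (x i) n)) (+∣i∣-square (y i))) ⟩
          + k * ∑[ i < k ] (y i * y i)     ≤⟨ ℤ.*-monoˡ-≤-nonNeg (+ k) ∑y²≤N ⟩
          + k * + N                        ∎))
          where
          open ℤ.≤-Reasoning
          f = fM c n M
          x : Fin k → ℕ
          x i = colourCountIn c M i
          y ∣y∣ : Fin k → ℤ
          y i = + x i - + n
          ∣y∣ i = + ℕ.∣ x i - n ∣
          ∑y²≤N : ∑[ i < k ] (y i * y i) ≤ + N
          ∑y²≤N = ℤ.*-cancelˡ-≤-pos _ (+ N) (+ 4) (subst (_≤ + 4 * + N) (imbalance-matching M) Ψ≤4N)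
          +f²≡ : + (f ℕ.^ 2) ≡ + f * + f
          +f²≡ = trans (cong (λ m → + (f ℕ.* m)) (ℕ.*-identityʳ f)) (ℤ.pos-* f f)
          +2nk²≡ : + (2 ℕ.* n ℕ.* k ℕ.^ 2) ≡ + k * + N
          +2nk²≡ = trans (cong +_ (trans (rearrange n k) (cong (k ℕ.*_) (sym N≡2kn)))) (ℤ.pos-* k N)
            where
            rearrange : ∀ n k → 2 ℕ.* n ℕ.* (k ℕ.* (k ℕ.* 1)) ≡ k ℕ.* (2 ℕ.* k ℕ.* n)
            rearrange = ℕ-solve-∀

        module _ (bal : ColourBalanced c) (k>0 : 0 ℕ.< k) where

          -- by balance, every colour class contains the same number of ordered pairs
          ∑≠-excess-colour : ∀ M → ∑≠ (λ u v → excess M (col c u v)) ≡ 0ℤ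
          ∑≠-excess-colour M = ℤ.*-cancelˡ-≡ (+ k) _ 0ℤ {{ℕ.>-nonZero k>0}} (begin
            + k * ∑≠ (λ u v → e (col c u v))           ≡⟨ cong (+ k *_) (∑≠-fibres (λ u v → col c u v) e) ⟩
            + k * ∑[ i < k ] (e i * W i)                ≡⟨ *-distribˡ-sum {k} (+ k) _ ⟩
            ∑[ i < k ] (+ k * (e i * W i))              ≡⟨ sum-cong-≗ (λ i → trans (rotate (+ k) (e i) (W i)) (cong (e i *_) (k*W≡2E i))) ⟩
            ∑[ i < k ] (e i * (+ 2 * + numEdges N))     ≡⟨ sym (*-distribʳ-sum {k} _ e) ⟩
            sum e * (+ 2 * + numEdges N)                ≡⟨ cong (_* (+ 2 * + numEdges N)) (∑-excess M) ⟩
            0ℤ                                          ≡⟨ sym (ℤ.*-zeroʳ (+ k)) ⟩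
            + k * 0ℤ                                    ∎)
            where
            open ≡-Reasoning
            e = excess M
            W : Fin k → ℤ
            W i = ∑≠ (λ u v → 𝟙 (col c u v ≟ i))
            rotate : ∀ x y z → x * (y * z) ≡ y * (z * x)
            rotate = solve-∀
            k*W≡2E : ∀ i → W i * + k ≡ + 2 * + numEdges N
            k*W≡2E i = begin
              W i * + k                                     ≡⟨ cong (_* + k) (∑≠-symmetric _ (λ u v → 𝟙-col-sym u v i)) ⟩
              + 2 * ∑[ u < N ] ∑[ v < N ] (𝟙 (u <? v) * 𝟙 (col c u v ≟ i)) * + k
                                                            ≡⟨ cong (λ s → + 2 * s * + k) (sym (colourClassSize-∑ i)) ⟩
              + 2 * + colourClassSize c i * + k             ≡⟨ ℤ.*-assoc (+ 2) (+ colourClassSize c i) (+ k) ⟩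
              + 2 * (+ colourClassSize c i * + k)           ≡⟨ cong (+ 2 *_) (trans (sym (ℤ.pos-* (colourClassSize c i) k)) (cong +_ (bal i))) ⟩
              + 2 * + numEdges N                            ∎

          ∑≠-gain : ∀ M → ∑≠ (gain M) ≡ - (+ 2 * ((+ N - 1ℤ) * imbalance M))
          ∑≠-gain M = begin
            ∑≠ (gain M)
              ≡⟨ trans (∑≠-distrib-minus (λ u v → a u v + b u v - c′ u v) d)
                       (cong (_- ∑≠ d) (trans (∑≠-distrib-minus (λ u v → a u v + b u v) c′) (cong (_- ∑≠ c′) (∑≠-distrib-+ a b)))) ⟩
            ∑≠ a + ∑≠ b - ∑≠ c′ - ∑≠ d
              ≡⟨ cong₂ _-_ (cong₂ _-_ (cong₂ _+_ (∑≠-excess-colour M) (trans (∑≠-involution p (involutive M) a) (∑≠-excess-colour M)))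
                                      (trans (∑≠-fst (λ u → e (col c u (p u)))) (cong ((+ N - 1ℤ) *_) (∑-excess-partner M))))
                           (trans (∑≠-snd (λ v → e (col c v (p v)))) (cong ((+ N - 1ℤ) *_) (∑-excess-partner M))) ⟩
            0ℤ + 0ℤ - (+ N - 1ℤ) * imbalance M - (+ N - 1ℤ) * imbalance M
              ≡⟨ collect ((+ N - 1ℤ) * imbalance M) ⟩
            - (+ 2 * ((+ N - 1ℤ) * imbalance M)) ∎
            where
            open ≡-Reasoning
            p = partner M
            e = excess M
            a b c′ d : Fin N → Fin N → ℤ
            a u v = e (col c u v)
            b u v = e (col c (p u) (p v))
            c′ u v = e (col c u (p u))
            d u v = e (col c v (p v))
            collect : ∀ x → 0ℤ + 0ℤ - x - x ≡ - (+ 2 * x)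
            collect = solve-∀

          ∑≠-switch-bound : ∀ M → ∑≠ (λ u v → + 4 * gain M u v + + 32) ≡ - (+ 8 * ((+ N - 1ℤ) * (imbalance M - + 4 * + N)))
          ∑≠-switch-bound M = begin
            ∑≠ (λ u v → + 4 * gain M u v + + 32)
              ≡⟨ trans (∑≠-distrib-+ (λ u v → + 4 * gain M u v) (λ _ _ → + 32))
                       (cong₂ _+_ (∑≠-*ˡ (+ 4) (gain M)) (∑≠-fst {N} (λ _ → + 32))) ⟩
            + 4 * ∑≠ (gain M) + (+ N - 1ℤ) * ∑[ u < N ] (+ 32)
              ≡⟨ cong₂ (λ g s → + 4 * g + (+ N - 1ℤ) * s) (∑≠-gain M) (∑-const N (+ 32)) ⟩
            + 4 * (- (+ 2 * ((+ N - 1ℤ) * imbalance M))) + (+ N - 1ℤ) * (+ N * + 32)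
              ≡⟨ collect (+ N) (imbalance M) ⟩
            - (+ 8 * ((+ N - 1ℤ) * (imbalance M - + 4 * + N))) ∎
            where
            open ≡-Reasoning
            collect : ∀ N Ψ → + 4 * (- (+ 2 * ((N - 1ℤ) * Ψ))) + (N - 1ℤ) * (N * + 32) ≡ - (+ 8 * ((N - 1ℤ) * (Ψ - + 4 * N)))
            collect = solve-∀

          switch-improves : 1 ℕ.< N → ∀ M → + 4 * + N < imbalance M → ∃ λ M′ → imbalance M′ < imbalance M
          switch-improves 1<N M 4N<Ψ with ∑≠-negative _ (subst (_< 0ℤ) (sym (∑≠-switch-bound M)) average<0)
            where
            average<0 : - (+ 8 * ((+ N - 1ℤ) * (imbalance M - + 4 * + N))) < 0ℤ
            average<0 = ℤ.neg-mono-< (*-positive {+ 8} (ℤ.+<+ (ℕ.s≤s ℕ.z≤n)) (*-positive (i<j⇒0<j-i (ℤ.+<+ 1<N)) (i<j⇒0<j-i 4N<Ψ)))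
          ... | u , v , u≢v , switch<0 = Switch.switchedMatching M u≢v v≢pu , ℤ.≤-<-trans (imbalance-switched-≤ M u≢v v≢pu) Ψ+switch<Ψ
            where
            v≢pu : v ≢ partner M u
            v≢pu refl = contradiction (subst (λ g → + 4 * g + + 32 < 0ℤ) (gain-partner M u) switch<0) λ { (ℤ.+<+ ()) }
            Ψ+switch<Ψ : imbalance M + (+ 4 * gain M u v + + 32) < imbalance M
            Ψ+switch<Ψ = subst (imbalance M + (+ 4 * gain M u v + + 32) <_) (ℤ.+-identityʳ (imbalance M)) (ℤ.+-monoʳ-< (imbalance M) switch<0)

open import Data.Nat using (ℕ; _*_; _^_; _≤_; _<_)
open import Data.Product using (Σ; _,_)
open import Relation.Binary.PropositionalEquality using (subst; sym; refl)
import Data.Nat.Properties as ℕ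

theorem2p1 : (n k : ℕ) → 0 < n → 0 < k →
    (c : EdgeColouring (2 * k * n) k) → ColourBalanced c →
    Σ (PerfectMatching (2 * k * n)) (λ M → fM c n M ^ 2 ≤ 2 * n * k ^ 2)
theorem2p1 n k n>0 k>0 c bal =
  let M , imbalance≤4N = descent (imbalance c n) _ (imbalance-nonNeg c n) (switch-improves c n refl bal k>0 1<2kn) M₀
  in M , fM-bound c n refl M imbalance≤4N
  where
  1<2kn : 1 < 2 * k * n
  1<2kn = ℕ.*-mono-≤ (ℕ.*-monoʳ-≤ 2 k>0) n>0
  M₀ : PerfectMatching (2 * k * n)
  M₀ = subst PerfectMatching (sym (ℕ.*-assoc 2 k n)) (evenMatching (k * n))
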